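{- Let $\mathcal{F}$ be a finite union-closed family of sets with $\emptyset\notin\mathcal{F}$, $n=|\bigcup_{A\in\mathcal{F}}A|$, $m=|\mathcal{F}|$, and height number $H(\mathcal{F})=2$. Then every element of $\bigcup_{A\in\mathcal{F}}A$ belongs to at least $m-1$ sets of $\mathcal{F}$, and there exists an element $x$ which belongs to more than half of the sets of $\mathcal{F}$.
   Context: A union-closed family is a finite family $\mathcal{F}$ of finite sets closed under pairwise union. Height decomposition: $\pi_1$ is the set of inclusion-minimal members of $\mathcal{F}$; inductively, while $\mathcal{F}\setminus(\pi_1\cup\dots\cup\pi_{i-1})\neq\emptyset$, $\pi_i$ is the set of inclusion-minimal members of $\mathcal{F}\setminus(\pi_1\cup\dots\cup\pi_{i-1})$; the number of steps until $\mathcal{F}$ is exhausted is the height number $H(\mathcal{F})$. -}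

module Defs where

open import Data.Nat using (ℕ; zero; suc)
open import Data.Bool using (Bool; not; _∨_; _∧_)
import Data.Bool as B
open import Data.List using (List; []; _∷_; length; filterᵇ)
open import Data.Fin using (Fin)
open import Data.Fin.Subset using (Subset; _⊆_)
open import Data.Fin.Subset.Properties using (_⊆?_; _∈?_)
open import Data.Vec.Properties using (≡-dec)
open import Relation.Nullary.Decidable using (isYes)

-- A family of subsets of the ground set Fin k is represented as a list
-- (duplicate-freeness is imposed in the statement).

allᵇ : ∀ {a} {X : Set a} → (X → Bool) → List X → Bool
allᵇ p []       = B.true
allᵇ p (x ∷ xs) = p x ∧ allᵇ p xs

_≟ˢ_ : ∀ {k} → (A B : Subset k) → _
_≟ˢ_ = ≡-dec B._≟_

-- A is an inclusion-minimal member of F (A assumed to be in F):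
-- every B ∈ F with B ⊆ A equals A.
isMinimal : ∀ {k} → List (Subset k) → Subset k → Bool
isMinimal F A = allᵇ (λ B → not (isYes (B ⊆? A)) ∨ isYes (B ≟ˢ A)) F

nonMinimals : ∀ {k} → List (Subset k) → List (Subset k)
nonMinimals F = filterᵇ (λ A → not (isMinimal F A)) F

heightAux : ∀ {k} → ℕ → List (Subset k) → ℕ
heightAux zero     F       = zero
heightAux (suc f)  []      = zero
heightAux (suc f)  (A ∷ F) = suc (heightAux f (nonMinimals (A ∷ F)))

-- height number H(F); each step removes at least one (minimal) member of a
-- duplicate-free nonempty family, so fuel |F| suffices.
height : ∀ {k} → List (Subset k) → ℕ
height F = heightAux (length F) F

degree : ∀ {k} → Fin k → List (Subset k) → ℕ
degree x F = length (filterᵇ (λ A → isYes (x ∈? A)) F)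

-- In a union-closed family F the union ⋃ F is itself a member, and a family of height 2
-- contains no chain D ⊊ C ⊊ ⋃ F; so the only member with a proper sub-member is ⋃ F.
-- If two distinct members A, B missed some x ∈ ⋃ F, then A ∪ B would be a member missing x,
-- hence different from ⋃ F, yet properly containing A or B.  So at most one member misses x,
-- i.e. deg x ≥ m − 1, which exceeds m/2 once m ≥ 3; for m = 2 the family is a pair A ⊊ B
-- and any x ∈ A lies in both members.

module Submission where

open import Defs
open import Data.Nat using (ℕ; _≤_; _<_; _∸_; _*_; _+_; suc; s≤s; s≤s⁻¹; z≤n)
open import Data.Nat.Properties using (≤-refl; ≤-trans; n≤1+n; m≤n+m; +-mono-≤; +-identityʳ; ∸-monoˡ-≤; module ≤-Reasoning)
open import Data.Bool using (Bool; false; not; _∧_; _∨_)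
open import Data.Bool.Properties using (∧-zeroʳ; T-not-≡)
open import Data.List using (List; []; _∷_; length; filter)
open import Data.List.Properties using (filter-all)
open import Data.List.Relation.Unary.All using (All; []; _∷_)
import Data.List.Relation.Unary.All as All
open import Data.List.Relation.Unary.AllPairs using (_∷_)
open import Data.List.Relation.Unary.Any using (here; there)
open import Data.List.Relation.Unary.Unique.Propositional using (Unique)
open import Data.List.Membership.Propositional using () renaming (_∈_ to _∈ᶠ_)
open import Data.List.Membership.Propositional.Properties using (∈-filter⁺)
open import Data.List.Relation.Binary.Subset.Propositional using () renaming (_⊆_ to _⊆ᶠ_)
open import Data.Fin using (Fin)
open import Data.Fin.Subset using (Subset; _∈_; _∉_; _∪_; _⊆_; ⊥; ⋃; Nonempty)
open import Data.Fin.Subset.Properties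
  using (_∈?_; _⊆?_; ⊆-antisym; p⊆p∪q; q⊆p∪q; x∈p∪q⁻; ∪-identityʳ; nonempty?; Empty-unique)
open import Data.Product using (∃; _×_; _,_)
open import Data.Sum using (_⊎_; inj₁; inj₂; [_,_])
open import Function using (_∘_; id; case_of_; Equivalence)
open import Level using (Level)
open import Relation.Nullary using (¬_; yes; no; contradiction)
open import Relation.Nullary.Decidable using (isYes; isYes≗does; dec-true; dec-false; fromWitness; T?)
open import Relation.Unary using (Pred; Decidable)
open import Relation.Binary.PropositionalEquality using (_≡_; _≢_; refl; sym; trans; subst; cong; cong₂)

private
  variable
    a p : Level
    X : Set a
    k : ℕ
    F : List (Subset k)
    A B C : Subset k
    x : Fin k

UnionClosed : List (Subset k) → Set
UnionClosed F = ∀ {A B} → A ∈ᶠ F → B ∈ᶠ F → (A ∪ B) ∈ᶠ F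

infix 4 _⊊_

-- Proper inclusion as inclusion plus inequality (Data.Fin.Subset's _⊂_ asks for an explicit
-- element of the difference).
_⊊_ : Subset k → Subset k → Set
A ⊊ B = A ⊆ B × A ≢ B

1≤length : ∀ {xs : List X} {u} → u ∈ᶠ xs → 1 ≤ length xs
1≤length (here _)  = s≤s z≤n
1≤length (there _) = s≤s z≤n

2≤length : ∀ {xs : List X} {u v} → u ∈ᶠ xs → v ∈ᶠ xs → u ≢ v → 2 ≤ length xs
2≤length (here refl) (here refl) u≢v = contradiction refl u≢v
2≤length (here refl) (there v∈)  _   = s≤s (1≤length v∈)
2≤length (there u∈)  (here refl) _   = s≤s (1≤length u∈)
2≤length (there u∈)  (there v∈)  u≢v = ≤-trans (2≤length u∈ v∈ u≢v) (n≤1+n _)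

3≤length : ∀ {xs : List X} {u v w} → u ∈ᶠ xs → v ∈ᶠ xs → w ∈ᶠ xs →
           u ≢ v → u ≢ w → v ≢ w → 3 ≤ length xs
3≤length (here refl) (here refl) _           u≢v _   _   = contradiction refl u≢v
3≤length (here refl) _           (here refl) _   u≢w _   = contradiction refl u≢w
3≤length (there _)   (here refl) (here refl) _   _   v≢w = contradiction refl v≢w
3≤length (here refl) (there v∈)  (there w∈)  _   _   v≢w = s≤s (2≤length v∈ w∈ v≢w)
3≤length (there u∈)  (here refl) (there w∈)  _   u≢w _   = s≤s (2≤length u∈ w∈ u≢w)
3≤length (there u∈)  (there v∈)  (here refl) u≢v _   _   = s≤s (2≤length u∈ v∈ u≢v)
3≤length (there u∈)  (there v∈)  (there w∈)  u≢v u≢w v≢w =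
  ≤-trans (3≤length u∈ v∈ w∈ u≢v u≢w v≢w) (n≤1+n _)

length≤1+length-filter : {P : Pred X p} (P? : Decidable P) {xs : List X} → Unique xs →
  (∀ {u v} → u ∈ᶠ xs → v ∈ᶠ xs → ¬ P u → ¬ P v → u ≡ v) →
  length xs ≤ suc (length (filter P? xs))
length≤1+length-filter P? {[]} _ _ = z≤n
length≤1+length-filter P? {u ∷ xs} (u∉xs ∷ unique) atMostOneFails with P? u
... | yes _  = s≤s (length≤1+length-filter P? unique λ v∈ w∈ → atMostOneFails (there v∈) (there w∈))
... | no ¬Pu = s≤s (subst (length xs ≤_) (cong length (sym (filter-all P? allSatisfy))) ≤-refl)
  where
  allSatisfy : All _ xs
  allSatisfy = All.tabulate λ {v} v∈xs → case P? v of λ where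
    (yes Pv) → Pv
    (no ¬Pv) → contradiction (sym (atMostOneFails (there v∈xs) (here refl) ¬Pv ¬Pu)) (All.lookup u∉xs v∈xs)

allᵇ-false : ∀ {q : X → Bool} {u xs} → u ∈ᶠ xs → q u ≡ false → allᵇ q xs ≡ false
allᵇ-false {q = q} {xs = _ ∷ xs} (here refl) qu≡false = cong (_∧ allᵇ q xs) qu≡false
allᵇ-false {q = q} {xs = v ∷ _}  (there u∈)  qu≡false =
  trans (cong (q v ∧_) (allᵇ-false u∈ qu≡false)) (∧-zeroʳ (q v))

∈-nonMinimals⁺ : A ∈ᶠ F → B ∈ᶠ F → B ⊊ A → A ∈ᶠ nonMinimals F
∈-nonMinimals⁺ {A = A} {F = F} {B = B} A∈F B∈F (B⊆A , B≢A) =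
  ∈-filter⁺ (T? ∘ λ A → not (isMinimal F A)) A∈F (Equivalence.from T-not-≡ (allᵇ-false B∈F B-witness))
  where
  B-witness : (not (isYes (B ⊆? A)) ∨ isYes (B ≟ˢ A)) ≡ false
  B-witness = cong₂ (λ s e → not s ∨ e) (trans (isYes≗does (B ⊆? A)) (dec-true (B ⊆? A) B⊆A))
                                       (trans (isYes≗does (B ≟ˢ A)) (dec-false (B ≟ˢ A) B≢A))

heightAux-suc : ∀ f → A ∈ᶠ F → heightAux (suc f) F ≡ suc (heightAux f (nonMinimals F))
heightAux-suc {F = _ ∷ _} f _ = refl

3≤heightAux : ∀ f → 3 ≤ f → A ∈ᶠ F → B ∈ᶠ nonMinimals F → C ∈ᶠ nonMinimals (nonMinimals F) →
              3 ≤ heightAux f F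
3≤heightAux (suc (suc (suc f))) (s≤s (s≤s (s≤s _))) A∈ B∈ C∈
  rewrite heightAux-suc (suc (suc f)) A∈ | heightAux-suc (suc f) B∈ | heightAux-suc f C∈ =
  s≤s (s≤s (s≤s z≤n))

-- The chain has three distinct members, which is what makes the fuel length F of height suffice.
chain⇒3≤height : A ∈ᶠ F → B ∈ᶠ F → C ∈ᶠ F → A ⊊ B → B ⊊ C → 3 ≤ height F
chain⇒3≤height {A = A} {F = F} {B = B} {C = C} A∈ B∈ C∈ A⊊B@(A⊆B , A≢B) B⊊C@(B⊆C , B≢C) =
  3≤heightAux _ (3≤length A∈ B∈ C∈ A≢B A≢C B≢C) A∈ B∈N C∈NN
  where
  A≢C : A ≢ C
  A≢C refl = A≢B (⊆-antisym A⊆B B⊆C)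
  B∈N : B ∈ᶠ nonMinimals F
  B∈N = ∈-nonMinimals⁺ B∈ A∈ A⊊B
  C∈NN : C ∈ᶠ nonMinimals (nonMinimals F)
  C∈NN = ∈-nonMinimals⁺ (∈-nonMinimals⁺ C∈ B∈ B⊊C) B∈N B⊊C

⊆⋃ : A ∈ᶠ F → A ⊆ ⋃ F
⊆⋃ {F = B ∷ F} (here refl) = p⊆p∪q (⋃ F)
⊆⋃ {F = B ∷ F} (there A∈F) = q⊆p∪q B (⋃ F) ∘ ⊆⋃ A∈F

⋃-closed : UnionClosed F → ∀ {B G} → (B ∷ G) ⊆ᶠ F → ⋃ (B ∷ G) ∈ᶠ F
⋃-closed _  {B} {[]}    B∷G⊆F rewrite ∪-identityʳ B = B∷G⊆F (here refl)
⋃-closed uc {B} {C ∷ G} B∷G⊆F = uc (B∷G⊆F (here refl)) (⋃-closed uc (B∷G⊆F ∘ there))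

⋃∈ : UnionClosed F → A ∈ᶠ F → ⋃ F ∈ᶠ F
⋃∈ {F = _ ∷ _} uc _ = ⋃-closed uc id

⊊-∪ : A ≢ B → A ⊊ A ∪ B ⊎ B ⊊ A ∪ B
⊊-∪ {A = A} {B = B} A≢B with A ≟ˢ (A ∪ B)
... | no A≢A∪B = inj₁ (p⊆p∪q B , A≢A∪B)
... | yes A≡A∪B = inj₂ (q⊆p∪q A B , λ B≡A∪B → A≢B (trans A≡A∪B (sym B≡A∪B)))

height≡2⇒⊋≡⋃ : UnionClosed F → height F ≡ 2 → A ∈ᶠ F → B ∈ᶠ F → A ⊊ B → B ≡ ⋃ F
height≡2⇒⊋≡⋃ {F = F} {B = B} uc h A∈ B∈ A⊊B with B ≟ˢ ⋃ F
... | yes B≡⋃F = B≡⋃F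
... | no  B≢⋃F = contradiction (subst (3 ≤_) h (chain⇒3≤height A∈ B∈ (⋃∈ uc A∈) A⊊B (⊆⋃ B∈ , B≢⋃F)))
                             λ { (s≤s (s≤s ())) }

height≡2⇒missing-unique : UnionClosed F → height F ≡ 2 → x ∈ ⋃ F →
  A ∈ᶠ F → B ∈ᶠ F → x ∉ A → x ∉ B → A ≡ B
height≡2⇒missing-unique {A = A} {B = B} uc h x∈⋃F A∈ B∈ x∉A x∉B with A ≟ˢ B
... | yes A≡B = A≡B
... | no  A≢B = contradiction (subst (_ ∈_) (sym A∪B≡⋃F) x∈⋃F) ([ x∉A , x∉B ] ∘ x∈p∪q⁻ A B)
  where
  A∪B≡⋃F : A ∪ B ≡ _
  A∪B≡⋃F = [ height≡2⇒⊋≡⋃ uc h A∈ (uc A∈ B∈) , height≡2⇒⊋≡⋃ uc h B∈ (uc A∈ B∈) ] (⊊-∪ A≢B)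

length≤1+degree : Unique F → UnionClosed F → height F ≡ 2 → x ∈ ⋃ F → length F ≤ suc (degree x F)
length≤1+degree {x = x} unique uc h x∈⋃F = length≤1+length-filter (T? ∘ λ A → isYes (x ∈? A)) unique
  λ A∈ B∈ x∉A x∉B → height≡2⇒missing-unique uc h x∈⋃F A∈ B∈ (x∉A ∘ fromWitness) (x∉B ∘ fromWitness)

degree≡length : All (x ∈_) F → degree x F ≡ length F
degree≡length {x = x} x∈all = cong length (filter-all (T? ∘ λ A → isYes (x ∈? A)) (All.map fromWitness x∈all))

∉⊥⇒nonempty : ¬ (⊥ ∈ᶠ F) → A ∈ᶠ F → Nonempty A
∉⊥⇒nonempty {A = A} ⊥∉F A∈F with nonempty? A
... | yes A-nonempty = A-nonempty
... | no  A-empty    = contradiction (subst (_∈ᶠ _) (Empty-unique A-empty) A∈F) ⊥∉F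

pair-⊆ : (A ∪ B) ∈ᶠ (A ∷ B ∷ []) → B ⊆ A ⊎ A ⊆ B
pair-⊆ {A = A} {B = B} (here A∪B≡A)         = inj₁ (subst (B ⊆_) A∪B≡A (q⊆p∪q A B))
pair-⊆ {A = A} {B = B} (there (here A∪B≡B)) = inj₂ (subst (A ⊆_) A∪B≡B (p⊆p∪q B))

pair-majority : x ∈ A → x ∈ B → 2 < 2 * degree x (A ∷ B ∷ [])
pair-majority x∈A x∈B rewrite degree≡length (x∈A ∷ x∈B ∷ []) = s≤s (s≤s (s≤s z≤n))

2+r≤d⇒3+r<2*d : ∀ {r d} → 2 + r ≤ d → 3 + r < 2 * d
2+r≤d⇒3+r<2*d {r} {d} 2+r≤d = begin-strict
  3 + r             <⟨ s≤s (s≤s (m≤n+m (2 + r) r)) ⟩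
  (2 + r) + (2 + r) ≤⟨ +-mono-≤ 2+r≤d 2+r≤d ⟩
  d + d             ≡⟨ cong (d +_) (sym (+-identityʳ d)) ⟩
  2 * d             ∎
  where open ≤-Reasoning

height≡2⇒∃majority : Unique F → UnionClosed F → ¬ (⊥ ∈ᶠ F) → height F ≡ 2 →
  ∃ λ x → length F < 2 * degree x F
height≡2⇒∃majority {F = []}    _ _ _ ()
height≡2⇒∃majority {F = _ ∷ []} _ _ _ ()
height≡2⇒∃majority {F = A ∷ B ∷ []} _ uc ⊥∉F _ =
  [ (λ B⊆A → let x , x∈B = ∉⊥⇒nonempty ⊥∉F (there (here refl)) in x , pair-majority (B⊆A x∈B) x∈B)
  , (λ A⊆B → let x , x∈A = ∉⊥⇒nonempty ⊥∉F (here refl)         in x , pair-majority x∈A (A⊆B x∈A))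
  ] (pair-⊆ (uc (here refl) (there (here refl))))
height≡2⇒∃majority {F = A ∷ B ∷ C ∷ G} unique uc ⊥∉F h =
  let x , x∈A = ∉⊥⇒nonempty ⊥∉F (here refl)
  in x , 2+r≤d⇒3+r<2*d (s≤s⁻¹ (length≤1+degree unique uc h (⊆⋃ {F = A ∷ B ∷ C ∷ G} (here refl) x∈A)))

corollary3p1p1 : ∀ (k : ℕ) (F : List (Subset k)) →
    Unique F →
    (∀ {A B} → A ∈ᶠ F → B ∈ᶠ F → (A ∪ B) ∈ᶠ F) →
    ¬ (⊥ ∈ᶠ F) →
    height F ≡ 2 →
    (∀ (x : Fin k) → x ∈ ⋃ F → length F ∸ 1 ≤ degree x F)
    × ∃ (λ (x : Fin k) → length F < 2 * degree x F)
corollary3p1p1 k F unique uc ⊥∉F h =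
  (λ x x∈⋃F → ∸-monoˡ-≤ 1 (length≤1+degree unique uc h x∈⋃F)) ,
  height≡2⇒∃majority unique uc ⊥∉F h
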